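{- Let $\mathcal H$ be a compressed subfamily of $2^{[n]}$ and let $w\colon\mathcal H\to\mathbb R^+$ satisfy $w(\delta_{i,j}(H))\ge w(H)$ for every $H\in\mathcal H$ and all $i,j\in[n]$ with $i<j$. Then $w^{(\mathcal H)}(\mathcal H(a))\le w^{(\mathcal H)}(\mathcal H(1))$ for each $a\in[n]$.
   Context: $\mathbb R^+$ is the set of positive reals. For $\mathcal A\subseteq\mathcal H$, $w^{(\mathcal H)}(\mathcal A)=\sum_{A\in\mathcal A}w(A)$ (empty sum $=0$). $\mathcal H(a)=\{H\in\mathcal H\colon a\in H\}$. For $i,j\in[n]$, $\delta_{i,j}(A)=(A\setminus\{j\})\cup\{i\}$ if $j\in A$ and $i\notin A$, and $\delta_{i,j}(A)=A$ otherwise. A family $\mathcal F\subseteq2^{[n]}$ is compressed if $(F\setminus\{j\})\cup\{i\}\in\mathcal F$ whenever $1\le i<j$, $j\in F\in\mathcal F$ and $i\in[n]\setminus F$. -}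

module Defs where

open import Level using (Level; suc; _⊔_)
open import Data.Nat.Base using (ℕ; zero) renaming (suc to sucℕ)
open import Data.Bool.Base using (Bool; true; false; _∧_; not; if_then_else_; T)
open import Data.Fin.Base using (Fin; _<_)
open import Data.Fin.Subset using (Subset; inside; outside; _∈_; _∉_)
open import Data.Vec.Base using (Vec; []; _∷_; lookup; _[_]≔_)
open import Data.List.Base using (List; []; _∷_; map; _++_; foldr; filterᵇ)
open import Relation.Binary.PropositionalEquality using (_≡_)

-- The (abstract) value domain of the weights: a commutative monoid with a
-- compatible preorder and a strict order.  The positive reals are weighted
-- in ℝ, which is an instance of this structure (ℝ itself is not in stdlib).
record OrderedCommMonoid (c ℓ : Level) : Set (suc (c ⊔ ℓ)) where
  infixl 6 _+_
  infix 4 _≤_ _<ʷ_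
  field
    Carrier : Set c
    0#      : Carrier
    _+_     : Carrier → Carrier → Carrier
    _≤_     : Carrier → Carrier → Set ℓ
    _<ʷ_    : Carrier → Carrier → Set ℓ
    +-assoc     : ∀ x y z → (x + y) + z ≡ x + (y + z)
    +-comm      : ∀ x y → x + y ≡ y + x
    +-identityˡ : ∀ x → 0# + x ≡ x
    ≤-refl      : ∀ {x} → x ≤ x
    ≤-trans     : ∀ {x y z} → x ≤ y → y ≤ z → x ≤ z
    +-mono-≤    : ∀ {x y u v} → x ≤ y → u ≤ v → x + u ≤ y + v
    <⇒≤         : ∀ {x y} → x <ʷ y → x ≤ y
    <-≤-trans   : ∀ {x y z} → x <ʷ y → y ≤ z → x <ʷ z
    ≤-<-trans   : ∀ {x y z} → x ≤ y → y <ʷ z → x <ʷ z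

-- All 2^n subsets of Fin n, each exactly once.
allSubsets : (n : ℕ) → List (Subset n)
allSubsets zero     = [] ∷ []
allSubsets (sucℕ n) = map (inside ∷_) (allSubsets n) ++ map (outside ∷_) (allSubsets n)

Family : ℕ → Set
Family n = Subset n → Bool

star : ∀ {n} → Family n → Fin n → Family n
star 𝓗 a A = 𝓗 A ∧ lookup A a

module _ {c ℓ} (M : OrderedCommMonoid c ℓ) where
  open OrderedCommMonoid M

  wsum : ∀ {n} → (Subset n → Carrier) → Family n → Carrier
  wsum {n} w 𝓐 = foldr (λ A s → w A + s) 0# (filterᵇ 𝓐 (allSubsets n))

δ : ∀ {n} → Fin n → Fin n → Subset n → Subset n
δ i j A = if lookup A j ∧ not (lookup A i) then (A [ j ]≔ outside) [ i ]≔ inside else A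

Compressed : ∀ {n} → Family n → Set
Compressed {n} 𝓗 = ∀ (i j : Fin n) (F : Subset n) → i < j → T (𝓗 F) → j ∈ F → i ∉ F →
  T (𝓗 ((F [ j ]≔ outside) [ i ]≔ inside))

-- Split 𝓗(a), a ≠ 1, according to whether its members contain 1.  Those that
-- do lie in 𝓗(1).  Those that do not are sent into 𝓗(1) by H ↦ δ_{1,a}(H),
-- which stays in 𝓗 by compression, does not decrease the weight, and is
-- injective with image among the members of 𝓗(1) avoiding a.  The two parts
-- of 𝓗(1) so reached are disjoint, and the remaining weights are nonnegative.
module Submission where

open import Defs
open import Data.Nat.Base using (ℕ; suc; z≤n; s≤s)
open import Data.Bool.Base using (Bool; true; false; T; _∧_; not; if_then_else_)
open import Data.Bool.Properties using (∧-identityʳ; ∧-zeroʳ)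
open import Data.Fin.Base using (Fin; zero; _<_) renaming (suc to fsuc)
open import Data.Fin.Subset using (Subset; inside; outside)
open import Data.Vec.Base using (_∷_; lookup; _[_]≔_; there)
open import Data.Vec.Properties using (lookup⇒[]=)
open import Data.List.Base using (List; []; _∷_; map; _++_; foldr; filterᵇ)
open import Data.Unit.Base using (tt)
open import Relation.Binary.PropositionalEquality
  using (_≡_; refl; sym; trans; cong; cong₂; subst; isEquivalence; module ≡-Reasoning)
open import Relation.Binary.Bundles using (Preorder)
import Relation.Binary.Reasoning.Preorder

module _ {c ℓ} (M : OrderedCommMonoid c ℓ) where
  open OrderedCommMonoid M

  ≡⇒≤ : ∀ {x y} → x ≡ y → x ≤ y
  ≡⇒≤ refl = ≤-refl

  ≤-preorder : Preorder c c ℓ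
  ≤-preorder = record
    { isPreorder = record { isEquivalence = isEquivalence ; reflexive = ≡⇒≤ ; trans = ≤-trans } }

  module ≤-Reasoning = Relation.Binary.Reasoning.Preorder ≤-preorder

  +-identityʳ : ∀ x → x + 0# ≡ x
  +-identityʳ x = trans (+-comm x 0#) (+-identityˡ x)

  +-interchange : ∀ x y u v → (x + y) + (u + v) ≡ (x + u) + (y + v)
  +-interchange x y u v = begin
    (x + y) + (u + v)  ≡⟨ +-assoc x y (u + v) ⟩
    x + (y + (u + v))  ≡⟨ cong (x +_) (sym (+-assoc y u v)) ⟩
    x + ((y + u) + v)  ≡⟨ cong (λ z → x + (z + v)) (+-comm y u) ⟩
    x + ((u + y) + v)  ≡⟨ cong (x +_) (+-assoc u y v) ⟩
    x + (u + (y + v))  ≡⟨ sym (+-assoc x u (y + v)) ⟩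
    (x + u) + (y + v)  ∎
    where open ≡-Reasoning

  [_]_ : Bool → Carrier → Carrier
  [ b ] x = if b then x else 0#

  [∧] : ∀ a b x → [ a ∧ b ] x ≡ [ b ] ([ a ] x)
  [∧] true  b     x = refl
  [∧] false true  x = refl
  [∧] false false x = refl

  [b]+[not-b] : ∀ b x → [ b ] x + [ not b ] x ≡ x
  [b]+[not-b] true  x = +-identityʳ x
  [b]+[not-b] false x = +-identityˡ x

  Σ : {A : Set} → List A → (A → Carrier) → Carrier
  Σ L g = foldr (λ x s → g x + s) 0# L

  Σ-cong : {A : Set} (L : List A) {g h : A → Carrier} → (∀ x → g x ≡ h x) → Σ L g ≡ Σ L h
  Σ-cong []      g≡h = refl
  Σ-cong (x ∷ L) g≡h = cong₂ _+_ (g≡h x) (Σ-cong L g≡h)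

  Σ-mono-≤ : {A : Set} (L : List A) {g h : A → Carrier} → (∀ x → g x ≤ h x) → Σ L g ≤ Σ L h
  Σ-mono-≤ []      g≤h = ≤-refl
  Σ-mono-≤ (x ∷ L) g≤h = +-mono-≤ (g≤h x) (Σ-mono-≤ L g≤h)

  Σ-zero : {A : Set} (L : List A) → Σ L (λ _ → 0#) ≡ 0#
  Σ-zero []      = refl
  Σ-zero (x ∷ L) = trans (cong (0# +_) (Σ-zero L)) (+-identityˡ 0#)

  Σ-+ : {A : Set} (L : List A) (g h : A → Carrier) → Σ L g + Σ L h ≡ Σ L (λ x → g x + h x)
  Σ-+ []      g h = +-identityˡ 0#
  Σ-+ (x ∷ L) g h = trans (+-interchange _ _ _ _) (cong (g x + h x +_) (Σ-+ L g h))

  Σ-++ : {A : Set} (L L′ : List A) (g : A → Carrier) → Σ (L ++ L′) g ≡ Σ L g + Σ L′ g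
  Σ-++ []      L′ g = sym (+-identityˡ _)
  Σ-++ (x ∷ L) L′ g = trans (cong (g x +_) (Σ-++ L L′ g)) (sym (+-assoc _ _ _))

  Σ-map : {A B : Set} (f : A → B) (L : List A) (g : B → Carrier) →
    Σ (map f L) g ≡ Σ L (λ x → g (f x))
  Σ-map f []      g = refl
  Σ-map f (x ∷ L) g = cong (g (f x) +_) (Σ-map f L g)

  Σ-filterᵇ : {A : Set} (g : A → Carrier) (P : A → Bool) (L : List A) →
    foldr (λ x s → g x + s) 0# (filterᵇ P L) ≡ Σ L (λ x → [ P x ] g x)
  Σ-filterᵇ g P []      = refl
  Σ-filterᵇ g P (x ∷ L) with P x
  ... | true  = cong (g x +_) (Σ-filterᵇ g P L)
  ... | false = trans (Σ-filterᵇ g P L) (sym (+-identityˡ _))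

  Σ-allSubsets-suc : ∀ m (g : Subset (suc m) → Carrier) →
    Σ (allSubsets (suc m)) g
      ≡ Σ (allSubsets m) (λ X → g (inside ∷ X)) + Σ (allSubsets m) (λ X → g (outside ∷ X))
  Σ-allSubsets-suc m g =
    trans (Σ-++ (map (inside ∷_) S) _ g) (cong₂ _+_ (Σ-map _ S g) (Σ-map _ S g))
    where S = allSubsets m

  -- Removing k is a bijection from the subsets containing k onto those avoiding it.
  Σ-allSubsets-remove : ∀ m (k : Fin m) (g : Subset m → Carrier) →
    Σ (allSubsets m) (λ S → [ lookup S k ] g (S [ k ]≔ outside))
      ≡ Σ (allSubsets m) (λ S → [ not (lookup S k) ] g S)
  Σ-allSubsets-remove (suc m) zero g = begin
    _                                             ≡⟨ Σ-allSubsets-suc m _ ⟩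
    Σ S (λ X → g (outside ∷ X)) + Σ S (λ _ → 0#)  ≡⟨ +-comm _ _ ⟩
    Σ S (λ _ → 0#) + Σ S (λ X → g (outside ∷ X))  ≡⟨ sym (Σ-allSubsets-suc m _) ⟩
    _                                             ∎
    where
      open ≡-Reasoning
      S = allSubsets m
  Σ-allSubsets-remove (suc m) (fsuc k) g = begin
    _    ≡⟨ Σ-allSubsets-suc m _ ⟩
    _    ≡⟨ cong₂ _+_ (Σ-allSubsets-remove m k (λ X → g (inside ∷ X)))
                      (Σ-allSubsets-remove m k (λ X → g (outside ∷ X))) ⟩
    _    ≡⟨ sym (Σ-allSubsets-suc m _) ⟩
    _    ∎
    where open ≡-Reasoning

  wsum≡Σ : ∀ {n} (w : Subset n → Carrier) (𝓐 : Family n) →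
    wsum M w 𝓐 ≡ Σ (allSubsets n) (λ A → [ 𝓐 A ] w A)
  wsum≡Σ {n} w 𝓐 = Σ-filterᵇ w 𝓐 (allSubsets n)

  module _ {m} (𝓗 : Family (suc m)) (w : Subset (suc m) → Carrier) (k : Fin m)
           (compressed : Compressed 𝓗)
           (w-nonneg : ∀ H → T (𝓗 H) → 0# ≤ w H)
           (w-mono : ∀ H (i j : Fin (suc m)) → T (𝓗 H) → i < j → w H ≤ w (δ i j H))
           where

    S : List (Subset m)
    S = allSubsets m

    w₁ : Subset m → Carrier
    w₁ X = [ 𝓗 (inside ∷ X) ] w (inside ∷ X)

    w₁-nonneg : ∀ X → 0# ≤ w₁ X
    w₁-nonneg X with 𝓗 (inside ∷ X) in e
    ... | true  = w-nonneg (inside ∷ X) (subst T (sym e) tt)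
    ... | false = ≤-refl

    δ-zero-suc : ∀ X → lookup X k ≡ true →
      δ zero (fsuc k) (outside ∷ X) ≡ inside ∷ (X [ k ]≔ outside)
    δ-zero-suc X X∋k rewrite X∋k = refl

    w-outside≤w₁-shifted : ∀ X → lookup X k ≡ true → T (𝓗 (outside ∷ X)) →
      w (outside ∷ X) ≤ w₁ (X [ k ]≔ outside)
    w-outside≤w₁-shifted X X∋k H∈𝓗
      with 𝓗 (inside ∷ (X [ k ]≔ outside))
         | compressed zero (fsuc k) (outside ∷ X) (s≤s z≤n) H∈𝓗 (there (lookup⇒[]= k X X∋k)) (λ ())
    ... | true | _ = subst (λ A → w (outside ∷ X) ≤ w A) (δ-zero-suc X X∋k)
                           (w-mono (outside ∷ X) zero (fsuc k) H∈𝓗 (s≤s z≤n))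

    star-outside≤w₁-shifted : ∀ X → [ 𝓗 (outside ∷ X) ∧ lookup X k ] w (outside ∷ X)
                                      ≤ [ lookup X k ] w₁ (X [ k ]≔ outside)
    star-outside≤w₁-shifted X with lookup X k in X∋k
    ... | false = ≡⇒≤ (cong ([_] _) (∧-zeroʳ (𝓗 (outside ∷ X))))
    ... | true with 𝓗 (outside ∷ X) in e
    ...   | false = w₁-nonneg (X [ k ]≔ outside)
    ...   | true  = w-outside≤w₁-shifted X X∋k (subst T (sym e) tt)

    wsum-star-zero : wsum M w (star 𝓗 zero) ≡ Σ S w₁
    wsum-star-zero = begin
      wsum M w (star 𝓗 zero)  ≡⟨ wsum≡Σ w _ ⟩
      _                       ≡⟨ Σ-allSubsets-suc m _ ⟩
      _                       ≡⟨ cong₂ _+_ inside-part outside-part ⟩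
      Σ S w₁ + 0#             ≡⟨ +-identityʳ _ ⟩
      Σ S w₁                  ∎
      where
        open ≡-Reasoning
        inside-part = Σ-cong S (λ X → cong ([_] _) (∧-identityʳ (𝓗 (inside ∷ X))))
        outside-part = trans (Σ-cong S (λ X → cong ([_] _) (∧-zeroʳ (𝓗 (outside ∷ X)))))
                             (Σ-zero S)

    wsum-star-suc≤wsum-star-zero : wsum M w (star 𝓗 (fsuc k)) ≤ wsum M w (star 𝓗 zero)
    wsum-star-suc≤wsum-star-zero = begin
      wsum M w (star 𝓗 (fsuc k))
        ≡⟨ trans (wsum≡Σ w _) (Σ-allSubsets-suc m _) ⟩
      Σ S (λ X → [ 𝓗 (inside ∷ X) ∧ lookup X k ] w (inside ∷ X))
        + Σ S (λ X → [ 𝓗 (outside ∷ X) ∧ lookup X k ] w (outside ∷ X))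
        ≲⟨ +-mono-≤ (≡⇒≤ (Σ-cong S (λ X → [∧] (𝓗 (inside ∷ X)) (lookup X k) _)))
                    (Σ-mono-≤ S star-outside≤w₁-shifted) ⟩
      Σ S (λ X → [ lookup X k ] w₁ X) + Σ S (λ X → [ lookup X k ] w₁ (X [ k ]≔ outside))
        ≡⟨ cong (Σ S (λ X → [ lookup X k ] w₁ X) +_) (Σ-allSubsets-remove m k w₁) ⟩
      Σ S (λ X → [ lookup X k ] w₁ X) + Σ S (λ X → [ not (lookup X k) ] w₁ X)
        ≡⟨ trans (Σ-+ S _ _) (Σ-cong S (λ X → [b]+[not-b] (lookup X k) (w₁ X))) ⟩
      Σ S w₁
        ≡⟨ sym wsum-star-zero ⟩
      wsum M w (star 𝓗 zero) ∎
      where open ≤-Reasoning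

lemma3p2 : ∀ {c ℓ} (M : OrderedCommMonoid c ℓ) (m : ℕ) (𝓗 : Family (suc m))
    (w : Subset (suc m) → OrderedCommMonoid.Carrier M) →
    Compressed 𝓗 →
    (∀ H → T (𝓗 H) → OrderedCommMonoid._<ʷ_ M (OrderedCommMonoid.0# M) (w H)) →
    (∀ H (i j : Fin (suc m)) → T (𝓗 H) → i < j → OrderedCommMonoid._≤_ M (w H) (w (δ i j H))) →
    (a : Fin (suc m)) →
    OrderedCommMonoid._≤_ M (wsum M w (star 𝓗 a)) (wsum M w (star 𝓗 zero))
lemma3p2 M m 𝓗 w compressed w-pos w-mono zero     = OrderedCommMonoid.≤-refl M
lemma3p2 M m 𝓗 w compressed w-pos w-mono (fsuc k) =
  wsum-star-suc≤wsum-star-zero M 𝓗 w k compressed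
    (λ H H∈𝓗 → OrderedCommMonoid.<⇒≤ M (w-pos H H∈𝓗)) w-mono
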